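{- Every caterpillar is neighborhood-prime.
   Context: A neighborhood-prime labeling of a simple graph $G$ with $N$ vertices is a bijection $f:V(G)\to\{1,\ldots,N\}$ such that for every vertex $v$ with $\deg(v)>1$, $\gcd\{f(u):u\in N(v)\}=1$, where $N(v)$ is the neighborhood of $v$; a graph admitting one is neighborhood-prime. A caterpillar is a tree in which every vertex is within distance $1$ of a central path. -}

module Defs where

open import Data.Nat using (ℕ; suc; _<_; _≤_)
open import Data.Nat.GCD using (gcd)
open import Data.Fin using (Fin; toℕ)
open import Data.Bool using (Bool; true; false; T)
open import Data.Bool.Properties using (T?)
open import Data.List using (List; []; _∷_; filter; map; foldr; length; _∷ʳ_)
open import Data.List.Base using (allFin)
open import Data.List.Membership.Propositional using (_∈_)
open import Data.List.Relation.Unary.Unique.Propositional using (Unique)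
open import Data.List.Relation.Unary.Linked using (Linked)
open import Data.Product using (Σ; ∃; _×_; _,_)
open import Data.Sum using (_⊎_)
open import Data.Empty using (⊥)
open import Relation.Nullary using (¬_)
open import Relation.Binary.PropositionalEquality using (_≡_)
open import Function.Definitions using (Bijective)

record Graph (n : ℕ) : Set where
  field
    adj    : Fin n → Fin n → Bool
    sym    : ∀ u v → adj u v ≡ adj v u
    irrefl : ∀ v → adj v v ≡ false

open Graph public

module _ {n : ℕ} (G : Graph n) where

  Adj : Fin n → Fin n → Set
  Adj u v = T (adj G u v)

  nbhd : Fin n → List (Fin n)
  nbhd v = filter (λ u → T? (adj G v u)) (allFin n)

  degree : Fin n → ℕ
  degree v = length (nbhd v)

  data Walk : Fin n → Fin n → Set where
    here : ∀ v → Walk v v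
    step : ∀ {u w v} → Adj u w → Walk w v → Walk u v

  Connected : Set
  Connected = ∀ u v → Walk u v

  IsPath : List (Fin n) → Set
  IsPath xs = Unique xs × Linked Adj xs

  IsCycle : List (Fin n) → Set
  IsCycle xs = 3 ≤ length xs × Unique xs × Σ (Fin n) (λ x → Σ (List (Fin n)) (λ ys →
                 xs ≡ x ∷ ys × Linked Adj ((x ∷ ys) ∷ʳ x)))

  Acyclic : Set
  Acyclic = ∀ xs → ¬ IsCycle xs

  IsTree : Set
  IsTree = Connected × Acyclic

  IsCaterpillar : Set
  IsCaterpillar = IsTree × Σ (List (Fin n)) (λ P → IsPath P ×
                    (∀ v → v ∈ P ⊎ Σ (Fin n) (λ u → u ∈ P × Adj v u)))

  gcdList : List ℕ → ℕ
  gcdList = foldr gcd 0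

  -- f : Fin n → Fin n bijective encodes the labelling v ↦ 1 + toℕ (f v) ∈ {1,…,n}
  label : (Fin n → Fin n) → Fin n → ℕ
  label f v = suc (toℕ (f v))

  IsNeighborhoodPrimeLabeling : (Fin n → Fin n) → Set
  IsNeighborhoodPrimeLabeling f =
    Bijective _≡_ _≡_ f ×
    (∀ v → 1 < degree v → gcdList (map (label f) (nbhd v)) ≡ 1)

  NeighborhoodPrime : Set
  NeighborhoodPrime = Σ (Fin n → Fin n) IsNeighborhoodPrimeLabeling

-- Vertices off the spine have at most one neighbour: a second one would close a cycle
-- through the spine.  Prolonging the spine at each end by an off-spine neighbour, where
-- one exists, gives a path P on which every vertex v of degree at least two sits between
-- two of its neighbours, as a v c.  List all vertices starting with P and label them
-- 1, …, n in the order "entries at even positions, then entries at odd positions":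
-- a and c are two apart in the list, so they get consecutive labels, and the labels
-- around v have gcd 1.

module Submission where

open import Defs hiding (sym)
import Defs
open import Axiom.UniquenessOfIdentityProofs using (module Decidable⇒UIP)
open import Data.Bool using (T)
open import Data.Bool.Properties using (T?)
open import Data.Empty using (⊥; ⊥-elim)
open import Data.Fin using (Fin; toℕ; cast)
import Data.Fin as Fin
open import Data.Fin.Properties using (_≟_; any?; injective⇒≤; toℕ-cast; cast-involutive)
open import Data.List
  using (List; []; _∷_; _++_; _∷ʳ_; length; lookup; reverse; filter; map; foldr; allFin)
open import Data.List.Base using (reverseAcc)
open import Data.List.Properties using (++-assoc; ∷-injective; reverse-++)
open import Data.List.Membership.Propositional using (_∈_; _∉_)
open import Data.List.Membership.Propositional.Properties
  using (∈-∃++; ∈-++⁻; ∈-++⁺ˡ; ∈-++⁺ʳ; ∈-lookup; ∈-filter⁺; ∈-filter⁻; ∈-allFin; ∈-map⁺)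
open import Data.List.Membership.Setoid.Properties using (unique⇒irrelevant)
open import Data.List.Relation.Binary.Permutation.Propositional
  using (_↭_; ↭-refl; ↭-sym; ↭-trans; prep; ↭⇒↭ₛ)
open import Data.List.Relation.Binary.Permutation.Propositional.Properties
  using (∈-resp-↭; ↭-reverse; ∷↭∷ʳ; ++-comm)
import Data.List.Relation.Binary.Permutation.Setoid.Properties as Permutationₛ
open import Data.List.Relation.Binary.Subset.Propositional using (_⊆_)
import Data.List.Relation.Unary.All as All
import Data.List.Relation.Unary.All.Properties as Allₚ
open import Data.List.Relation.Unary.All.Properties using (¬Any⇒All¬)
open import Data.List.Relation.Unary.Any as Any using (here; there)
open import Data.List.Relation.Unary.Any.Properties using (lookup-index)
open import Data.List.Relation.Unary.Linked as Linked using (Linked; []; [-]; _∷_)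
open import Data.List.Relation.Unary.Unique.Propositional using (Unique; []; _∷_)
open import Data.List.Relation.Unary.Unique.Propositional.Properties
  using (Unique[x∷xs]⇒x∉xs; allFin⁺)
import Data.List.Relation.Unary.Unique.Propositional.Properties as Unique
open import Data.Nat using (ℕ; suc; _≤_; _<_; z≤n; s≤s)
open import Data.Nat.Divisibility using (_∣_; ∣-trans; ∣1⇒≡1; ∣m+n∣m⇒∣n)
open import Data.Nat.GCD using (gcd; gcd[m,n]∣m; gcd[m,n]∣n)
open import Data.Nat.Properties using (≤-antisym; +-comm; <⇒≱)
open import Data.Product using (∃; ∃₂; _×_; _,_; proj₁; proj₂)
import Data.Product as Product
open import Data.Sum using (_⊎_; inj₁; inj₂)
open import Function using (_∘_; _∋_; case_of_)
open import Function.Definitions using (Injective; Surjective)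
open import Relation.Binary.Definitions using (Symmetric)
open import Relation.Binary.PropositionalEquality
  using (_≡_; refl; sym; trans; cong; subst; setoid; module ≡-Reasoning)
open import Relation.Nullary using (¬_; yes; no)
open import Relation.Nullary.Decidable using (_×-dec_; ¬?)

module _ {A : Set} where

  Adjacent : A → A → List A → Set
  Adjacent a b xs = ∃₂ λ us vs → xs ≡ us ++ a ∷ b ∷ vs

  Flanked : A → A → A → List A → Set
  Flanked a b c xs = ∃₂ λ us vs → xs ≡ us ++ a ∷ b ∷ c ∷ vs

  Adjacent-++⁺ˡ : ∀ {a b : A} {xs} ys → Adjacent a b xs → Adjacent a b (ys ++ xs)
  Adjacent-++⁺ˡ ys (us , vs , refl) = ys ++ us , vs , sym (++-assoc ys us _)

  Adjacent-++⁺ʳ : ∀ {a b : A} {xs} ys → Adjacent a b xs → Adjacent a b (xs ++ ys)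
  Adjacent-++⁺ʳ ys (us , vs , refl) = us , vs ++ ys , ++-assoc us _ ys

  Flanked-++⁺ʳ : ∀ {a b c : A} {xs} ys → Flanked a b c xs → Flanked a b c (xs ++ ys)
  Flanked-++⁺ʳ ys (us , vs , refl) = us , vs ++ ys , ++-assoc us _ ys

  Adjacent-reverse : ∀ {a b : A} {xs} → Adjacent a b xs → Adjacent b a (reverse xs)
  Adjacent-reverse {a} {b} (us , vs , refl) = reverse vs , reverse us , (begin
    reverse (us ++ a ∷ b ∷ vs)                ≡⟨ reverse-++ us (a ∷ b ∷ vs) ⟩
    reverse (a ∷ b ∷ vs) ++ reverse us
      ≡⟨ cong (_++ reverse us) (reverse-++ (a ∷ b ∷ []) vs) ⟩
    (reverse vs ++ b ∷ a ∷ []) ++ reverse us  ≡⟨ ++-assoc (reverse vs) _ _ ⟩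
    reverse vs ++ b ∷ a ∷ reverse us          ∎)
    where open ≡-Reasoning

  Adjacent⇒∈ : ∀ {a b : A} {xs} → Adjacent a b xs → b ∈ xs
  Adjacent⇒∈ (us , vs , refl) = ∈-++⁺ʳ us (there (here refl))

  ∈⇒Adjacent : ∀ {v x : A} {xs} → v ∈ xs → ∃ λ u → Adjacent u v (x ∷ xs)
  ∈⇒Adjacent {x = x} (here refl) = x , [] , _ , refl
  ∈⇒Adjacent {x = x} (there v∈xs) with u , us , vs , eq ← ∈⇒Adjacent v∈xs =
    u , x ∷ us , vs , cong (x ∷_) eq

  Unique-resp-↭ : ∀ {xs ys : List A} → xs ↭ ys → Unique xs → Unique ys
  Unique-resp-↭ = Permutationₛ.Unique-resp-↭ (setoid A) ∘ ↭⇒↭ₛ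

  ∈-reverse⁺ : ∀ {v : A} {xs} → v ∈ xs → v ∈ reverse xs
  ∈-reverse⁺ {xs = xs} = ∈-resp-↭ (↭-sym (↭-reverse xs))

  Unique-reverse : ∀ {xs : List A} → Unique xs → Unique (reverse xs)
  Unique-reverse {xs} = Unique-resp-↭ (↭-sym (↭-reverse xs))

  Unique-++⁻ʳ : ∀ (xs : List A) {ys} → Unique (xs ++ ys) → Unique ys
  Unique-++⁻ʳ []       u       = u
  Unique-++⁻ʳ (x ∷ xs) (_ ∷ u) = Unique-++⁻ʳ xs u

  Unique-prefix : ∀ (xs : List A) {y ys} → Unique (xs ++ y ∷ ys) → Unique (xs ∷ʳ y)
  Unique-prefix []       _        = All.[] ∷ []
  Unique-prefix (x ∷ xs) (x∉ ∷ u) =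
    Allₚ.++⁺ (Allₚ.++⁻ˡ xs x∉) (All.head (Allₚ.++⁻ʳ xs x∉) All.∷ All.[]) ∷ Unique-prefix xs u

  Unique-split : ∀ {v : A} us {vs} us′ {vs′} → Unique (us ++ v ∷ vs) →
                 us ++ v ∷ vs ≡ us′ ++ v ∷ vs′ → us ≡ us′
  Unique-split []       []        _          _    = refl
  Unique-split []       (u ∷ us′) uniq       refl =
    ⊥-elim (Unique[x∷xs]⇒x∉xs uniq (∈-++⁺ʳ us′ (here refl)))
  Unique-split (u ∷ us) []        uniq       refl =
    ⊥-elim (Unique[x∷xs]⇒x∉xs uniq (∈-++⁺ʳ us (here refl)))
  Unique-split (u ∷ us) (_ ∷ us′) (_ ∷ uniq) eq with refl , eq′ ← ∷-injective eq =
    cong (u ∷_) (Unique-split us us′ uniq eq′)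

  Unique-flank : ∀ {a b c : A} {xs} →
                 Unique xs → Adjacent a b xs → Adjacent b c xs → Flanked a b c xs
  Unique-flank {a} {b} {c} uniq (us , vs , refl) (us′ , vs′ , eq) = us , vs′ , (begin
    us ++ a ∷ b ∷ vs           ≡⟨ eq ⟩
    us′ ++ b ∷ c ∷ vs′         ≡⟨ cong (_++ b ∷ c ∷ vs′) split ⟨
    (us ∷ʳ a) ++ b ∷ c ∷ vs′   ≡⟨ ++-assoc us (a ∷ []) _ ⟩
    us ++ a ∷ b ∷ c ∷ vs′      ∎)
    where
    open ≡-Reasoning
    reassoc : us ++ a ∷ b ∷ vs ≡ (us ∷ʳ a) ++ b ∷ vs
    reassoc = sym (++-assoc us (a ∷ []) (b ∷ vs))
    split : us ∷ʳ a ≡ us′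
    split = Unique-split (us ∷ʳ a) us′ (subst Unique reassoc uniq) (trans (sym reassoc) eq)

  Unique-subsingleton⇒length≤1 : ∀ {xs : List A} →
    Unique xs → (∀ {a b} → a ∈ xs → b ∈ xs → a ≡ b) → length xs ≤ 1
  Unique-subsingleton⇒length≤1 {[]}        _                   _    = z≤n
  Unique-subsingleton⇒length≤1 {_ ∷ []}    _                   _    = s≤s z≤n
  Unique-subsingleton⇒length≤1 {_ ∷ _ ∷ _} ((x≢y All.∷ _) ∷ _) all≡ =
    ⊥-elim (x≢y (all≡ (here refl) (there (here refl))))

  evens odds : List A → List A
  evens []       = []
  evens (x ∷ xs) = x ∷ odds xs
  odds  []       = []
  odds  (x ∷ xs) = evens xs

  deinterleave : List A → List A
  deinterleave xs = evens xs ++ odds xs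

  deinterleave-↭ : ∀ xs → deinterleave xs ↭ xs
  deinterleave-↭ []       = ↭-refl
  deinterleave-↭ (x ∷ xs) = prep x (↭-trans (++-comm (odds xs) (evens xs)) (deinterleave-↭ xs))

  Unique-deinterleave : ∀ {xs} → Unique xs → Unique (deinterleave xs)
  Unique-deinterleave {xs} = Unique-resp-↭ (↭-sym (deinterleave-↭ xs))

  ∈-deinterleave⁺ : ∀ {v xs} → v ∈ xs → v ∈ deinterleave xs
  ∈-deinterleave⁺ {xs = xs} = ∈-resp-↭ (↭-sym (deinterleave-↭ xs))

  Adjacent-evens⊎odds : ∀ {a b c : A} us {vs} →
    Adjacent a c (evens (us ++ a ∷ b ∷ c ∷ vs)) ⊎ Adjacent a c (odds (us ++ a ∷ b ∷ c ∷ vs))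
  Adjacent-evens⊎odds []       {vs} = inj₁ ([] , odds vs , refl)
  Adjacent-evens⊎odds (u ∷ us)      with Adjacent-evens⊎odds us
  ... | inj₁ in-evens = inj₂ in-evens
  ... | inj₂ in-odds  = inj₁ (Adjacent-++⁺ˡ (u ∷ []) in-odds)

  Flanked⇒Adjacent-deinterleave : ∀ {a b c : A} {xs} →
                                  Flanked a b c xs → Adjacent a c (deinterleave xs)
  Flanked⇒Adjacent-deinterleave (us , vs , refl) with Adjacent-evens⊎odds us
  ... | inj₁ in-evens = Adjacent-++⁺ʳ _ in-evens
  ... | inj₂ in-odds  = Adjacent-++⁺ˡ _ in-odds

module _ {A : Set} {R : A → A → Set} where

  Linked-++⁻ʳ : ∀ (xs : List A) {ys} → Linked R (xs ++ ys) → Linked R ys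
  Linked-++⁻ʳ []       l = l
  Linked-++⁻ʳ (x ∷ xs) l = Linked-++⁻ʳ xs (Linked.tail l)

  Linked-prefix : ∀ (xs : List A) {y ys} → Linked R (xs ++ y ∷ ys) → Linked R (xs ∷ʳ y)
  Linked-prefix []            _       = [-]
  Linked-prefix (x ∷ [])      (r ∷ _) = r ∷ [-]
  Linked-prefix (x ∷ x′ ∷ xs) (r ∷ l) = r ∷ Linked-prefix (x′ ∷ xs) l

  Linked-window : ∀ (xs : List A) {a b c ys} →
                  Linked R (xs ++ a ∷ b ∷ c ∷ ys) → R a b × R b c
  Linked-window []       (r ∷ r′ ∷ _) = r , r′
  Linked-window (x ∷ xs) l            = Linked-window xs (Linked.tail l)

  Linked-reverseAcc : Symmetric R → ∀ {x : A} acc xs →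
                      Linked R (x ∷ acc) → Linked R (x ∷ xs) → Linked R (reverseAcc (x ∷ acc) xs)
  Linked-reverseAcc sym-R acc []       l-acc _       = l-acc
  Linked-reverseAcc sym-R acc (y ∷ xs) l-acc (r ∷ l) =
    Linked-reverseAcc sym-R (_ ∷ acc) xs (sym-R r ∷ l-acc) l

  Linked-reverse : Symmetric R → ∀ {xs : List A} → Linked R xs → Linked R (reverse xs)
  Linked-reverse sym-R {[]}     _ = []
  Linked-reverse sym-R {x ∷ xs} l = Linked-reverseAcc sym-R [] xs [-] l

module _ {n : ℕ} (G : Graph n) where

  open import Data.List.Membership.DecPropositional (_≟_ {n}) using (_∈?_)

  AtMostOneNeighbour : Fin n → Set
  AtMostOneNeighbour v = ∀ {u w} → Adj G v u → Adj G v w → u ≡ w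

  Dominating : List (Fin n) → Set
  Dominating P = ∀ v → v ∈ P ⊎ ∃ λ u → u ∈ P × Adj G v u

  Adj-sym : ∀ {u v} → Adj G u v → Adj G v u
  Adj-sym {u} {v} = subst T (Defs.sym G u v)

  Adj-irrefl : ∀ {v} → ¬ Adj G v v
  Adj-irrefl {v} = subst T (irrefl G v)

  neighbours≡⇒AtMostOne : ∀ {v u} → (∀ {w} → Adj G v w → w ≡ u) → AtMostOneNeighbour v
  neighbours≡⇒AtMostOne ≡u vw vw′ = trans (≡u vw) (sym (≡u vw′))

  IsPath-∷⁺ : ∀ {v x xs} →
              v ∉ x ∷ xs → Adj G v x → IsPath G (x ∷ xs) → IsPath G (v ∷ x ∷ xs)
  IsPath-∷⁺ v∉ vx (uniq , linked) = ¬Any⇒All¬ _ v∉ ∷ uniq , vx ∷ linked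

  IsPath-++⁻ʳ : ∀ xs {ys} → IsPath G (xs ++ ys) → IsPath G ys
  IsPath-++⁻ʳ xs = Product.map (Unique-++⁻ʳ xs) (Linked-++⁻ʳ xs)

  IsPath-prefix : ∀ xs {y ys} → IsPath G (xs ++ y ∷ ys) → IsPath G (xs ∷ʳ y)
  IsPath-prefix xs = Product.map (Unique-prefix xs) (Linked-prefix xs)

  IsPath-reverse : ∀ {xs} → IsPath G xs → IsPath G (reverse xs)
  IsPath-reverse = Product.map Unique-reverse (Linked-reverse Adj-sym)

  Flanked⇒Adj : ∀ {P a v c} → IsPath G P → Flanked a v c P → Adj G v a × Adj G v c
  Flanked⇒Adj (_ , linked) (us , vs , refl) = Product.map₁ Adj-sym (Linked-window us linked)

  degree>1⇒¬AtMostOne : ∀ {v} → 1 < degree G v → ¬ AtMostOneNeighbour v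
  degree>1⇒¬AtMostOne {v} deg atMostOne =
    <⇒≱ deg (Unique-subsingleton⇒length≤1 (Unique.filter⁺ _ (allFin⁺ n)) λ u∈ w∈ →
      atMostOne (adjacent u∈) (adjacent w∈))
    where
    adjacent : ∀ {u} → u ∈ nbhd G v → Adj G v u
    adjacent = proj₂ ∘ ∈-filter⁻ (λ w → T? (adj G v w)) {xs = allFin n}

  module _ (acyclic : Acyclic G) where

    -- The edge p w would close the cycle w p q … w.
    no-chord : ∀ {p q L w} → IsPath G (p ∷ q ∷ L) → w ∈ L → ¬ Adj G p w
    no-chord {p} {q} {w = w} (uniq , linked) w∈L pw with L₁ , L₂ , refl ← ∈-∃++ w∈L =
      acyclic (w ∷ p ∷ q ∷ L₁)
        ( s≤s (s≤s (s≤s z≤n))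
        , Unique-resp-↭ (↭-sym (∷↭∷ʳ w (p ∷ q ∷ L₁))) (Unique-prefix (p ∷ q ∷ L₁) uniq)
        , w , p ∷ q ∷ L₁ , refl , Adj-sym pw ∷ Linked-prefix (p ∷ q ∷ L₁) linked)

    subpath-from : ∀ {P u x} → IsPath G P → u ∈ P → x ∈ P →
                   ∃ λ L → IsPath G (u ∷ L) × x ∈ u ∷ L × u ∷ L ⊆ P
    subpath-from {u = u} path u∈P x∈P with A , B , refl ← ∈-∃++ u∈P with ∈-++⁻ A x∈P
    ... | inj₂ x∈uB = B , IsPath-++⁻ʳ A path , x∈uB , ∈-++⁺ʳ A
    ... | inj₁ x∈A  = reverse A
                    , subst (IsPath G) (reverse-++ A (u ∷ [])) (IsPath-reverse (IsPath-prefix A path))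
                    , there (∈-reverse⁺ x∈A)
                    , λ { (here refl) → ∈-++⁺ʳ A (here refl)
                        ; (there y∈) → ∈-++⁺ˡ (∈-resp-↭ (↭-reverse A) y∈) }

    off-path⇒AtMostOne : ∀ {P v} → IsPath G P → Dominating P → v ∉ P → AtMostOneNeighbour v
    off-path⇒AtMostOne {P} {v} path dominating v∉P with dominating v
    ... | inj₁ v∈P            = ⊥-elim (v∉P v∈P)
    ... | inj₂ (u , u∈P , vu) = neighbours≡⇒AtMostOne only-u
      where
      only-u : ∀ {w} → Adj G v w → w ≡ u
      only-u {w} vw with w ∈? P
      ... | yes w∈P with L , uL , w∈uL , uL⊆P ← subpath-from path u∈P w∈P with w∈uL
      ...   | here w≡u  = w≡u
      ...   | there w∈L = ⊥-elim (no-chord (IsPath-∷⁺ (v∉P ∘ uL⊆P) vu uL) w∈L vw)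
      only-u {w} vw | no w∉P with dominating w
      ... | inj₁ w∈P            = ⊥-elim (w∉P w∈P)
      ... | inj₂ (x , x∈P , wx) with L , uL , x∈uL , uL⊆P ← subpath-from path u∈P x∈P =
        ⊥-elim (no-chord (IsPath-∷⁺ w∉vuL (Adj-sym vw) (IsPath-∷⁺ (v∉P ∘ uL⊆P) vu uL)) x∈uL wx)
        where
        w∉vuL : w ∉ v ∷ u ∷ L
        w∉vuL (here refl) = Adj-irrefl vw
        w∉vuL (there w∈)  = w∉P (uL⊆P w∈)

    branching⇒on-path : ∀ {P} → IsPath G P → Dominating P → ∀ v → ¬ AtMostOneNeighbour v → v ∈ P
    branching⇒on-path {P} path dominating v branching with v ∈? P
    ... | yes v∈P = v∈P
    ... | no v∉P  = ⊥-elim (branching (off-path⇒AtMostOne path dominating v∉P))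

    endpoint⇒AtMostOne : ∀ {p L} →
      IsPath G (p ∷ L) → (∀ {w} → Adj G p w → w ∈ L) → AtMostOneNeighbour p
    endpoint⇒AtMostOne {L = []}    _    inL pw = case inL pw of λ ()
    endpoint⇒AtMostOne {p} {q ∷ L} path inL    = neighbours≡⇒AtMostOne only-q
      where
      only-q : ∀ {w} → Adj G p w → w ≡ q
      only-q pw with inL pw
      ... | here w≡q  = w≡q
      ... | there w∈L = ⊥-elim (no-chord path w∈L pw)

    extend-head : ∀ {P} → IsPath G P → (∀ v → ¬ AtMostOneNeighbour v → v ∈ P) →
      ∃ λ Y → IsPath G (Y ++ P) × (∀ v → ¬ AtMostOneNeighbour v → ∃ λ u → Adjacent u v (Y ++ P))
    extend-head {[]}    path on-path = [] , path , λ v branching → case on-path v branching of λ ()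
    extend-head {p ∷ L} path on-path with any? (λ y → T? (adj G p y) ×-dec ¬? (y ∈? p ∷ L))
    ... | yes (y , py , y∉P) = y ∷ [] , IsPath-∷⁺ y∉P (Adj-sym py) path
                             , λ v branching → ∈⇒Adjacent (on-path v branching)
    ... | no no-exit = [] , path , λ v branching → case on-path v branching of λ where
          (here refl)  → ⊥-elim (branching (endpoint⇒AtMostOne path in-L))
          (there v∈L) → ∈⇒Adjacent v∈L
      where
      in-L : ∀ {w} → Adj G p w → w ∈ L
      in-L {w} pw with w ∈? L
      ... | yes w∈L = w∈L
      ... | no w∉L  = ⊥-elim (no-exit (w , pw , λ where
                        (here refl) → Adj-irrefl pw
                        (there w∈L) → w∉L w∈L))

    spine-extension : ∀ {P} → IsPath G P → Dominating P →
      ∃ λ P′ → IsPath G P′ × (∀ v → ¬ AtMostOneNeighbour v → ∃₂ λ a c → Flanked a v c P′)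
    spine-extension path dominating
      with Y₁ , path₁ , pred₁ ← extend-head path (branching⇒on-path path dominating)
      with Y₂ , path₂ , pred₂ ← extend-head (IsPath-reverse path₁)
                                             (λ v b → ∈-reverse⁺ (Adjacent⇒∈ (proj₂ (pred₁ v b))))
      = _ , path₂ , λ v b →
        let a , a-v = pred₂ v b
            c , c-v = pred₁ v b
        in a , c , Unique-flank (proj₁ path₂) a-v (Adjacent-++⁺ˡ Y₂ (Adjacent-reverse c-v))

gcd-fold-∣ : ∀ {x} xs → x ∈ xs → foldr gcd 0 xs ∣ x
gcd-fold-∣ (y ∷ xs) (here refl) = gcd[m,n]∣m y (foldr gcd 0 xs)
gcd-fold-∣ (y ∷ xs) (there x∈) = ∣-trans (gcd[m,n]∣n y (foldr gcd 0 xs)) (gcd-fold-∣ xs x∈)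

gcd-fold-consecutive : ∀ {k} xs → k ∈ xs → suc k ∈ xs → foldr gcd 0 xs ≡ 1
gcd-fold-consecutive {k} xs k∈ 1+k∈ =
  ∣1⇒≡1 (∣m+n∣m⇒∣n (subst (foldr gcd 0 xs ∣_) (+-comm 1 k) (gcd-fold-∣ xs 1+k∈))
                   (gcd-fold-∣ xs k∈))

index-∈-lookup : ∀ {A : Set} (xs : List A) i → Any.index (∈-lookup {xs = xs} i) ≡ i
index-∈-lookup (x ∷ xs) Fin.zero    = refl
index-∈-lookup (x ∷ xs) (Fin.suc i) = cong Fin.suc (index-∈-lookup xs i)

index-∈-++⁺ʳ-consecutive : ∀ {A : Set} (us : List A) {a c vs} →
  toℕ (Any.index (c ∈ us ++ a ∷ c ∷ vs ∋ ∈-++⁺ʳ us (there (here refl))))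
    ≡ suc (toℕ (Any.index (a ∈ us ++ a ∷ c ∷ vs ∋ ∈-++⁺ʳ us (here refl))))
index-∈-++⁺ʳ-consecutive []       = refl
index-∈-++⁺ʳ-consecutive (u ∷ us) = cong suc (index-∈-++⁺ʳ-consecutive us)

module Enumeration {n : ℕ} {S : List (Fin n)} (unique : Unique S) (complete : ∀ v → v ∈ S) where

  ∈S-irrelevant : ∀ {v} (p q : v ∈ S) → p ≡ q
  ∈S-irrelevant = unique⇒irrelevant (setoid (Fin n)) (Decidable⇒UIP.≡-irrelevant _≟_) unique

  index : Fin n → Fin (length S)
  index v = Any.index (complete v)

  lookup∘index : ∀ v → lookup S (index v) ≡ v
  lookup∘index v = sym (lookup-index (complete v))

  index∘lookup : ∀ i → index (lookup S i) ≡ i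
  index∘lookup i = trans (cong Any.index (∈S-irrelevant _ (∈-lookup i))) (index-∈-lookup S i)

  length≡n : length S ≡ n
  length≡n = ≤-antisym
    (injective⇒≤ λ {i} {j} eq → trans (sym (index∘lookup i)) (trans (cong index eq) (index∘lookup j)))
    (injective⇒≤ λ {v} {w} eq → trans (sym (lookup∘index v)) (trans (cong (lookup S) eq) (lookup∘index w)))

  position : Fin n → Fin n
  position v = cast length≡n (index v)

  position-injective : Injective _≡_ _≡_ position
  position-injective {v} {w} eq = begin
    v                               ≡⟨ lookup∘index v ⟨
    lookup S (index v)              ≡⟨ cong (lookup S) (uncast v) ⟨
    lookup S (cast _ (position v))  ≡⟨ cong (lookup S ∘ cast (sym length≡n)) eq ⟩
    lookup S (cast _ (position w))  ≡⟨ cong (lookup S) (uncast w) ⟩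
    lookup S (index w)              ≡⟨ lookup∘index w ⟩
    w                               ∎
    where
    open ≡-Reasoning
    uncast : ∀ u → cast (sym length≡n) (position u) ≡ index u
    uncast u = cast-involutive (sym length≡n) length≡n (index u)

  position-surjective : Surjective _≡_ _≡_ position
  position-surjective y = lookup S i , λ { refl →
    trans (cong (cast length≡n) (index∘lookup i)) (cast-involutive length≡n (sym length≡n) y) }
    where i = cast (sym length≡n) y

  position-adjacent : ∀ {a c} → Adjacent a c S → toℕ (position c) ≡ suc (toℕ (position a))
  position-adjacent {a} {c} (us , vs , refl) = begin
    toℕ (position c)                              ≡⟨ toℕ-cast length≡n (index c) ⟩
    toℕ (index c)                                 ≡⟨ cong (toℕ ∘ Any.index) (∈S-irrelevant _ _) ⟩
    toℕ (Any.index (∈-++⁺ʳ us (there (here refl)))) ≡⟨ index-∈-++⁺ʳ-consecutive us ⟩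
    suc (toℕ (Any.index (∈-++⁺ʳ us (here refl))))   ≡⟨ cong (suc ∘ toℕ ∘ Any.index) (∈S-irrelevant _ _) ⟩
    suc (toℕ (index a))                           ≡⟨ cong suc (toℕ-cast length≡n (index a)) ⟨
    suc (toℕ (position a))                        ∎
    where open ≡-Reasoning

consecutive-neighbours⇒NeighborhoodPrime :
  ∀ {n} (G : Graph n) {S : List (Fin n)} → Unique S → (∀ v → v ∈ S) →
  (∀ v → 1 < degree G v → ∃₂ λ a c → Adj G v a × Adj G v c × Adjacent a c S) →
  NeighborhoodPrime G
consecutive-neighbours⇒NeighborhoodPrime G unique complete consecutive =
  position , (position-injective , position-surjective) , gcd≡1
  where
  open Enumeration unique complete
  gcd≡1 : ∀ v → 1 < degree G v → gcdList G (map (label G position) (nbhd G v)) ≡ 1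
  gcd≡1 v deg with a , c , va , vc , a-c ← consecutive v deg =
    gcd-fold-consecutive labels (label∈ va)
      (subst (_∈ labels) (cong suc (position-adjacent a-c)) (label∈ vc))
    where
    labels = map (label G position) (nbhd G v)
    label∈ : ∀ {u} → Adj G v u → label G position u ∈ labels
    label∈ {u} vu = ∈-map⁺ (label G position) (∈-filter⁺ (λ w → T? (adj G v w)) (∈-allFin u) vu)

extend-to-enumeration : ∀ {n} {P : List (Fin n)} →
  Unique P → ∃ λ R → Unique (P ++ R) × (∀ v → v ∈ P ++ R)
extend-to-enumeration {n} {P} unique =
  rest , Unique.++⁺ unique (Unique.filter⁺ _ (allFin⁺ n)) disjoint , complete
  where
  open import Data.List.Membership.DecPropositional (_≟_ {n}) using (_∈?_)
  rest = filter (λ v → ¬? (v ∈? P)) (allFin n)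
  disjoint : ∀ {v} → v ∈ P × v ∈ rest → ⊥
  disjoint (v∈P , v∈rest) = proj₂ (∈-filter⁻ (λ v → ¬? (v ∈? P)) {xs = allFin n} v∈rest) v∈P
  complete : ∀ v → v ∈ P ++ rest
  complete v with v ∈? P
  ... | yes v∈P = ∈-++⁺ˡ v∈P
  ... | no v∉P  = ∈-++⁺ʳ P (∈-filter⁺ (λ v → ¬? (v ∈? P)) (∈-allFin v) v∉P)

mainTheorem11 : (n : ℕ) (G : Graph n) → IsCaterpillar G → NeighborhoodPrime G
mainTheorem11 n G ((_ , acyclic) , _ , path , dominating)
  with _ , path′ , flanked ← spine-extension G acyclic path dominating
  with R , unique , complete ← extend-to-enumeration (proj₁ path′)
  = consecutive-neighbours⇒NeighborhoodPrime G
      (Unique-deinterleave unique) (∈-deinterleave⁺ ∘ complete) λ v deg →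
      let a , c , window = flanked v (degree>1⇒¬AtMostOne G deg)
          va , vc        = Flanked⇒Adj G path′ window
      in a , c , va , vc , Flanked⇒Adjacent-deinterleave (Flanked-++⁺ʳ R window)
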